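{- For all points $O,A,B,C$: (reflexivity) if $O\neq A$ then $A$ and $A$ lie on the same half-line from $O$; (symmetry) if $A,B$ lie on the same half-line from $O$, then $B,A$ lie on the same half-line from $O$; (transitivity) if $A,B$ lie on the same half-line from $O$ and $B,C$ lie on the same half-line from $O$, then $A,C$ lie on the same half-line from $O$.
   Context: Synthetic plane geometry with classical logic. Primitive notions: points, lines (with equality), incidence $A\in x$, a ternary betweenness relation $\mathrm{Bet}(A,B,C)$ on points ("$B$ strictly between $A$ and $C$"), lengths with a map $(A,B)\mapsto|AB|$. Points are collinear if some line contains all of them. Axioms: (incidence) there is a point; for every point there is a distinct point; every line has a point; for every line $x$ and $A\in x$ there is $B\in x$, $B\neq A$; for every line there is a point not on it; through two distinct points there is a line; if $A\neq B$, $A,B\in x$ and $x\neq y$ then $A\notin y$ or $B\notin y$. (betweenness) if $\mathrm{Bet}(A,B,C)$ then $A\neq C$, $A,B,C$ are collinear, $\mathrm{Bet}(C,B,A)$, and not $\mathrm{Bet}(B,A,C)$. (lengths) $|AB|=|CC|$ iff $A=B$; $|AB|=|BA|$. (line–circle) for $O,A,B$ with $A\neq O$ there is $C$ with ($\mathrm{Bet}(A,O,C)$ or $O=C$) and $|OB|=|OC|$. "$A,B$ lie on opposite sides of line $x$": $A,B\notin x$ and some $O\in x$ has $\mathrm{Bet}(A,O,B)$; "same side": $A,B\notin x$ and no such $O$. (Pasch) if $A,B$ lie on opposite sides of $x$ and $C\notin x$, then $A,C$ or $C,B$ lie on opposite sides of $x$. Definition: "$A$ and $B$ lie on the same half-line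 from $O$" means $O\neq A$, $O\neq B$, $O,A,B$ are collinear, and not $\mathrm{Bet}(A,O,B)$. -}

module Defs where

open import Data.Product using (Σ; ∃; _×_; _,_)
open import Data.Sum using (_⊎_)
open import Relation.Nullary using (¬_)
open import Relation.Binary.PropositionalEquality using (_≡_)

record Plane : Set₁ where
  field
    Point  : Set
    Line   : Set
    Length : Set
    _∈_    : Point → Line → Set
    Bet    : Point → Point → Point → Set
    len    : Point → Point → Length

  Collinear : Point → Point → Point → Set
  Collinear A B C = Σ Line λ x → (A ∈ x) × (B ∈ x) × (C ∈ x)

  OppositeSides : Point → Point → Line → Set
  OppositeSides A B x = ¬ (A ∈ x) × ¬ (B ∈ x) × Σ Point λ O → (O ∈ x) × Bet A O B

  field
    lem : (P : Set) → P ⊎ ¬ P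
    somePoint   : Point
    otherPoint  : ∀ A → Σ Point λ B → ¬ (B ≡ A)
    linePoint   : ∀ x → Σ Point λ A → A ∈ x
    lineOther   : ∀ x A → A ∈ x → Σ Point λ B → (B ∈ x) × ¬ (B ≡ A)
    offLine     : ∀ x → Σ Point λ A → ¬ (A ∈ x)
    lineThrough : ∀ A B → ¬ (A ≡ B) → Σ Line λ x → (A ∈ x) × (B ∈ x)
    lineUnique  : ∀ A B x y → ¬ (A ≡ B) → A ∈ x → B ∈ x → ¬ (x ≡ y)
                  → ¬ (A ∈ y) ⊎ ¬ (B ∈ y)
    bet-neq  : ∀ {A B C} → Bet A B C → ¬ (A ≡ C)
    bet-col  : ∀ {A B C} → Bet A B C → Collinear A B C
    bet-sym  : ∀ {A B C} → Bet A B C → Bet C B A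
    bet-not  : ∀ {A B C} → Bet A B C → ¬ Bet B A C
    len-zero : ∀ A B C → (len A B ≡ len C C → A ≡ B) × (A ≡ B → len A B ≡ len C C)
    len-sym  : ∀ A B → len A B ≡ len B A
    lineCircle : ∀ O A B → ¬ (A ≡ O)
                 → Σ Point λ C → (Bet A O C ⊎ O ≡ C) × (len O B ≡ len O C)
    pasch : ∀ A B C x → OppositeSides A B x → ¬ (C ∈ x)
            → OppositeSides A C x ⊎ OppositeSides C B x

  SameHalfLine : Point → Point → Point → Set
  SameHalfLine O A B = ¬ (O ≡ A) × ¬ (O ≡ B) × Collinear O A B × ¬ Bet A O B

-- A point O on a line x splits it: if Bet A O C, then every other point B of x
-- is separated by O from A or from C.  This is Pasch's axiom applied to a
-- second line through O, which meets x only at O.  So if O separated A from C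
-- while B lay on the same half-line as both, O would separate B from one of
-- them; this gives transitivity, and reflexivity and symmetry are immediate.
module Submission where

open import Defs
open import Data.Product using (_×_; _,_; Σ)
open import Data.Sum using (_⊎_; inj₁; inj₂; [_,_])
open import Data.Empty using (⊥-elim)
open import Relation.Nullary using (¬_)
open import Relation.Binary.PropositionalEquality using (_≡_; refl; subst)

module HalfLine (P : Plane) where
  open Plane P

  line-unique : ∀ {A B x y} → ¬ (A ≡ B) → A ∈ x → B ∈ x → A ∈ y → B ∈ y → x ≡ y
  line-unique {A} {B} {x} {y} A≢B Ax Bx Ay By with lem (x ≡ y)
  ... | inj₁ x≡y = x≡y
  ... | inj₂ x≢y with lineUnique A B x y A≢B Ax Bx x≢y
  ...   | inj₁ A∉y = ⊥-elim (A∉y Ay)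
  ...   | inj₂ B∉y = ⊥-elim (B∉y By)

  bet-middle-∈ : ∀ {U M V x} → U ∈ x → V ∈ x → Bet U M V → M ∈ x
  bet-middle-∈ Ux Vx b with bet-col b
  ... | z , Uz , Mz , Vz = subst (_ ∈_) (line-unique (bet-neq b) Uz Vz Ux Vx) Mz

  bet-left-≢ : ∀ {A O C} → Bet A O C → ¬ (O ≡ A)
  bet-left-≢ b refl = bet-not b b

  bet-right-≢ : ∀ {A O C} → Bet A O C → ¬ (O ≡ C)
  bet-right-≢ b = bet-left-≢ (bet-sym b)

  transversal : ∀ {O x} → O ∈ x → Σ Line λ y → O ∈ y × (∀ {Q} → Q ∈ x → Q ∈ y → Q ≡ O)
  transversal {O} {x} Ox with offLine x
  ... | D , D∉x with lineThrough O D O≢D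
    where
    O≢D : ¬ (O ≡ D)
    O≢D refl = D∉x Ox
  ...   | y , Oy , Dy = y , Oy , meets-only-at-O
    where
    meets-only-at-O : ∀ {Q} → Q ∈ x → Q ∈ y → Q ≡ O
    meets-only-at-O {Q} Qx Qy with lem (Q ≡ O)
    ... | inj₁ Q≡O = Q≡O
    ... | inj₂ Q≢O = ⊥-elim (D∉x (subst (D ∈_) (line-unique Q≢O Qy Oy Qx Ox) Dy))

  bet-split : ∀ {O A B C x} → O ∈ x → A ∈ x → B ∈ x → C ∈ x → ¬ (O ≡ B) →
              Bet A O C → Bet A O B ⊎ Bet B O C
  bet-split {O} {A} {B} {C} {x} Ox Ax Bx Cx O≢B AOC with transversal Ox
  ... | y , Oy , meet with pasch A C B y
                             (off Ax (bet-left-≢ AOC) , off Cx (bet-right-≢ AOC) , O , Oy , AOC)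
                             (off Bx O≢B)
    where
    off : ∀ {Q} → Q ∈ x → ¬ (O ≡ Q) → ¬ (Q ∈ y)
    off Qx O≢Q Qy with meet Qx Qy
    ... | refl = O≢Q refl
  ...   | inj₁ (_ , _ , M , My , AMB) =
          inj₁ (subst (λ M → Bet A M B) (meet (bet-middle-∈ Ax Bx AMB) My) AMB)
  ...   | inj₂ (_ , _ , M , My , BMC) =
          inj₂ (subst (λ M → Bet B M C) (meet (bet-middle-∈ Bx Cx BMC) My) BMC)

  same-half-line-refl : ∀ {O A} → ¬ (O ≡ A) → SameHalfLine O A A
  same-half-line-refl {O} {A} O≢A with lineThrough O A O≢A
  ... | x , Ox , Ax = O≢A , O≢A , (x , Ox , Ax , Ax) , λ AOA → bet-neq AOA refl

  same-half-line-sym : ∀ {O A B} → SameHalfLine O A B → SameHalfLine O B A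
  same-half-line-sym (O≢A , O≢B , (x , Ox , Ax , Bx) , ¬AOB) =
    O≢B , O≢A , (x , Ox , Bx , Ax) , λ BOA → ¬AOB (bet-sym BOA)

  same-half-line-trans : ∀ {O A B C} → SameHalfLine O A B → SameHalfLine O B C →
                         SameHalfLine O A C
  same-half-line-trans {C = C} (O≢A , O≢B , (x , Ox , Ax , Bx) , ¬AOB)
                       (_ , O≢C , (x′ , Ox′ , Bx′ , Cx′) , ¬BOC) =
    O≢A , O≢C , (x , Ox , Ax , Cx) , λ AOC → [ ¬AOB , ¬BOC ] (bet-split Ox Ax Bx Cx O≢B AOC)
    where
    Cx : C ∈ x
    Cx = subst (_ ∈_) (line-unique O≢B Ox′ Bx′ Ox Bx) Cx′

theorem6 : (P : Plane) → let open Plane P in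
    ∀ (O A B C : Point) →
      (¬ (O ≡ A) → SameHalfLine O A A)
      × (SameHalfLine O A B → SameHalfLine O B A)
      × (SameHalfLine O A B → SameHalfLine O B C → SameHalfLine O A C)
theorem6 P O A B C = same-half-line-refl , same-half-line-sym , same-half-line-trans
  where open HalfLine P
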